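{- Let $G$ be the grid defined in the context. For all integers $0\le j<i$ and every $x\in\{[G(i,k)]_3:k\ge0\}$ (the base-3 values of row $i$), there exist $a,b\in\{[G(j,k)]_3:k\ge0\}$ (base-3 values of row $j$) with $a<b<x$ and $b-a=x-b$; that is, $x$ is the last term of a 3-term arithmetic progression whose first two terms are base-3 values of strings in row $j$.
   Context: For a finite string $w=a_na_{n-1}\cdots a_0$ over digits $\{0,1,2\}$ let $[w]_{3/2}=\sum_k a_k(3/2)^k$ and $[w]_3=\sum_k a_k3^k$. Define an operation $T$ on such strings ("adding 2 in base $\frac32$"): if $w$ contains no digit $0$, first replace $w$ by $0w$; then change the rightmost $0$ of $w$ into $2$, change every digit to the right of it by $1\mapsto0$, $2\mapsto1$, and leave all digits to the left of it unchanged. Then $[T(w)]_{3/2}=[w]_{3/2}+2$. The grid $G$ has entries $G(i,j)$ (row $i$, column $j$, $i,j\ge0$): $G(0,j)$ is the binary representation of $j$ (so row $0$ is $0,1,10,11,100,\dots$), and $G(i+1,j)=T(G(i,j))$. -}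

module Defs where

open import Data.Nat using (ℕ; zero; suc; _+_; _*_)
open import Data.Fin using (Fin; zero; suc; toℕ)
open import Data.List using (List; []; _∷_; reverse)

-- A digit string over {0,1,2}.  Strings are stored LEAST-significant digit
-- first: the string a_n a_{n-1} ... a_0 is the list a_0 ∷ a_1 ∷ ... ∷ a_n ∷ [].
Digit : Set
Digit = Fin 3

Str : Set
Str = List Digit

val3 : Str → ℕ
val3 []       = 0
val3 (d ∷ ds) = toℕ d + 3 * val3 ds

-- The operation T ("adding 2 in base 3/2"), on LSB-first lists:
-- digits to the right of the rightmost 0 (i.e. the initial segment of the
-- list) are decremented 1↦0, 2↦1; the rightmost 0 becomes 2; digits to its
-- left are unchanged.  If there is no 0, a leading 0 is prepended first,
-- which becomes 2 (appended at the end of the LSB-first list).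
T : Str → Str
T []             = suc (suc zero) ∷ []
T (zero ∷ ds)    = suc (suc zero) ∷ ds
T (suc zero ∷ ds)       = zero ∷ T ds
T (suc (suc zero) ∷ ds) = suc zero ∷ T ds

incBin : Str → Str
incBin []       = suc zero ∷ []
incBin (zero ∷ ds)    = suc zero ∷ ds
incBin (suc _ ∷ ds)   = zero ∷ incBin ds

bin : ℕ → Str
bin zero    = zero ∷ []
bin (suc n) = incBin (bin n)

iterT : ℕ → Str → Str
iterT zero    w = w
iterT (suc i) w = T (iterT i w)

G : ℕ → ℕ → Str
G i j = iterT i (bin j)

InRow : ℕ → ℕ → Set
InRow i x = Data.Product.∃ λ k → val3 (G i k) Relation.Binary.PropositionalEquality.≡ x
  where import Data.Product; import Relation.Binary.PropositionalEquality

-- Strategy.  (1) Rows are described by values.  Iterating T on d ∷ w changes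
-- the lowest digit along 0 ↦ 2 ↦ 1 ↦ 0 and applies T to w at the steps 2 ↦ 1
-- and 1 ↦ 0; the bookkeeping identity 3·r + e = 2·n + d (a "Carry") shows that the values of
-- row n are exactly the numbers e + 3u with u a value of row r, where the
-- column bit d ∈ {0,1} is free.  This yields the inductive predicate Row,
-- equivalent to membership in a row (row-sound, row-complete).
-- (2) Progressions are built digit by digit, by induction on Row.  Writing the
-- rows as t + 3q, a progression ending at x = e + 3u is obtained from one ending
-- at u, but the higher parts may need a progression of a slightly different
-- Shape (non-strict, or off by one); four shapes are closed under this step.
-- Which digits and which shape to use depends only on finitely many data
-- (shape, residues of i and j, the bit of x, whether q < p); the existence of
-- such a Plan is checked by evaluating a decision procedure (`plans`), and a
-- single lemma (`extend`) proves every plan sound.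
-- (3) The theorem is the shape `proper` of this construction.
module Submission where

open import Defs
open import Data.Nat using (ℕ; _+_; _<_)
open import Data.Product using (Σ; _×_; _,_)
open import Relation.Binary.PropositionalEquality using (_≡_)

open import Data.Bool using (Bool; true; false)
open import Data.Empty using (⊥-elim)
open import Data.Fin using (Fin; zero; suc; toℕ; inject₁)
open import Data.Fin.Properties using (toℕ<n; toℕ-inject₁; all?; any?)
open import Data.List using ([]; _∷_)
open import Data.Nat using (zero; suc; _*_; _≤_; _%_; _/_; z≤n; z<s; NonZero)
open import Data.Nat.DivMod using (DivMod; _divMod_; m≡m%n+[m/n]*n; [m+kn]%n≡m%n; m<n⇒m%n≡m; m%n<n)
open import Data.Nat.Induction using (<-wellFounded)
open import Data.Nat.Properties
open import Data.Nat.Tactic.RingSolver using (solve-∀)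
open import Data.Product using (proj₁; proj₂)
open import Data.Sum using (_⊎_; inj₁; inj₂)
open import Data.Unit using (⊤; tt)
open import Induction.WellFounded using (Acc; acc)
open import Relation.Binary.Definitions using (tri<; tri≈; tri>)
open import Relation.Binary.PropositionalEquality using (refl; sym; trans; cong; cong₂; subst; module ≡-Reasoning)
open import Relation.Nullary using (Dec; yes)
open import Relation.Nullary.Decidable using (map′; _×-dec_; _⊎-dec_; _→-dec_; toWitness)

base3-unique : ∀ {r e r′ e′} → e < 3 → e′ < 3 → 3 * r + e ≡ 3 * r′ + e′ → e ≡ e′ × r ≡ r′
base3-unique {r} {e} {r′} {e′} e<3 e′<3 eq =
  e≡e′ , *-cancelˡ-≡ r r′ 3 (+-cancelʳ-≡ e (3 * r) (3 * r′) (trans eq (cong (3 * r′ +_) (sym e≡e′))))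
  where
    low : ∀ q d → d < 3 → (3 * q + d) % 3 ≡ d
    low q d d<3 = begin
      (3 * q + d) % 3  ≡⟨ cong (_% 3) (trans (+-comm (3 * q) d) (cong (d +_) (*-comm 3 q))) ⟩
      (d + q * 3) % 3  ≡⟨ [m+kn]%n≡m%n d q 3 ⟩
      d % 3            ≡⟨ m<n⇒m%n≡m d<3 ⟩
      d                ∎
      where open ≡-Reasoning
    e≡e′ : e ≡ e′
    e≡e′ = trans (sym (low r e e<3)) (trans (cong (_% 3) eq) (low r′ e′ e′<3))

-- Effect of iterating T on the lowest digit of a string: the digit runs through
-- the cycle 0 ↦ 2 ↦ 1 ↦ 0 ↦ ⋯ and every step 1 ↦ 0 or 2 ↦ 1 applies T once to the
-- higher digits.  `lowest n d` is the lowest digit after n steps together with the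
-- number of times T has been applied to the higher digits.
tick : Digit × ℕ → Digit × ℕ
tick (zero , r)             = suc (suc zero) , r
tick (suc zero , r)         = zero , suc r
tick (suc (suc zero) , r)   = suc zero , suc r

lowest : ℕ → Digit → Digit × ℕ
lowest zero    d = d , 0
lowest (suc n) d = tick (lowest n d)

iterT-cons : ∀ n d w → iterT n (d ∷ w) ≡ proj₁ (lowest n d) ∷ iterT (proj₂ (lowest n d)) w
iterT-cons zero    d w = refl
iterT-cons (suc n) d w rewrite iterT-cons n d w with lowest n d
... | zero , r           = refl
... | suc zero , r       = refl
... | suc (suc zero) , r = refl

-- The base-3/2 bookkeeping behind T: a step of T raises 2·n + d by 2, and it
-- raises 3·r + e by 2 as well (r counts the T-steps passed to the higher digits).
tick-balance : ∀ p → 3 * proj₂ (tick p) + toℕ (proj₁ (tick p)) ≡ 2 + (3 * proj₂ p + toℕ (proj₁ p))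
tick-balance (zero , r)           = from0 r
  where from0 : ∀ r → 3 * r + 2 ≡ 2 + (3 * r + 0)
        from0 = solve-∀
tick-balance (suc zero , r)       = from1 r
  where from1 : ∀ r → 3 * suc r + 0 ≡ 2 + (3 * r + 1)
        from1 = solve-∀
tick-balance (suc (suc zero) , r) = from2 r
  where from2 : ∀ r → 3 * suc r + 1 ≡ 2 + (3 * r + 2)
        from2 = solve-∀

lowest-balance : ∀ n d → 3 * proj₂ (lowest n d) + toℕ (proj₁ (lowest n d)) ≡ 2 * n + toℕ d
lowest-balance zero    d = refl
lowest-balance (suc n) d = begin
  3 * proj₂ (lowest (suc n) d) + toℕ (proj₁ (lowest (suc n) d)) ≡⟨ tick-balance (lowest n d) ⟩
  2 + (3 * proj₂ (lowest n d) + toℕ (proj₁ (lowest n d)))       ≡⟨ cong (2 +_) (lowest-balance n d) ⟩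
  2 + (2 * n + toℕ d)                                           ≡⟨ sym (+-assoc 2 (2 * n) (toℕ d)) ⟩
  2 + 2 * n + toℕ d                                             ≡⟨ cong (_+ toℕ d) (sym (*-suc 2 n)) ⟩
  2 * suc n + toℕ d                                             ∎
  where open ≡-Reasoning

bin-even : ∀ k → bin (2 * suc k) ≡ zero ∷ bin (suc k)
bin-even zero    = refl
bin-even (suc k) = begin
  bin (2 * suc (suc k))            ≡⟨ cong bin (*-suc 2 (suc k)) ⟩
  incBin (incBin (bin (2 * suc k))) ≡⟨ cong (λ w → incBin (incBin w)) (bin-even k) ⟩
  zero ∷ bin (suc (suc k))          ∎
  where open ≡-Reasoning

bin-bit : ∀ (b : Fin 2) k → bin (toℕ b + 2 * suc k) ≡ inject₁ b ∷ bin (suc k)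
bin-bit zero       k = bin-even k
bin-bit (suc zero) k = cong incBin (bin-even k)

iterT-T : ∀ r w → iterT (suc r) w ≡ iterT r (T w)
iterT-T zero    w = refl
iterT-T (suc r) w = cong T (iterT-T r w)

-- The empty string and the string 0 agree after any number of T-steps (T maps
-- both to 2); this covers the column k = 0, whose string is 0 and not empty.
iterT-empty : ∀ r → val3 (iterT r []) ≡ val3 (iterT r (zero ∷ []))
iterT-empty zero    = refl
iterT-empty (suc r) = cong val3 (trans (iterT-T r []) (sym (iterT-T r (zero ∷ []))))

column-digit : ∀ n (b : Fin 2) k →
  val3 (G n (toℕ b + 2 * k)) ≡ toℕ (proj₁ (lowest n (inject₁ b))) + 3 * val3 (G (proj₂ (lowest n (inject₁ b))) k)
column-digit n b k = trans (cong val3 (cong (iterT n) (bin-cons b k))) (lift k)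
  where
    open ≡-Reasoning
    e : Digit
    e = proj₁ (lowest n (inject₁ b))
    r : ℕ
    r = proj₂ (lowest n (inject₁ b))
    tail : ℕ → Str
    tail zero    = []
    tail (suc k) = bin (suc k)
    bin-cons : ∀ b k → bin (toℕ b + 2 * k) ≡ inject₁ b ∷ tail k
    bin-cons zero       zero    = refl
    bin-cons (suc zero) zero    = refl
    bin-cons b          (suc k) = bin-bit b k
    lift : ∀ k → val3 (iterT n (inject₁ b ∷ tail k)) ≡ toℕ e + 3 * val3 (G r k)
    lift zero    = begin
      val3 (iterT n (inject₁ b ∷ [])) ≡⟨ cong val3 (iterT-cons n (inject₁ b) []) ⟩
      toℕ e + 3 * val3 (iterT r [])   ≡⟨ cong (λ v → toℕ e + 3 * v) (iterT-empty r) ⟩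
      toℕ e + 3 * val3 (G r zero)     ∎
    lift (suc k) = cong val3 (iterT-cons n (inject₁ b) (bin (suc k)))

-- `Carry n e r` says: a string in row n whose column has lowest bit `bit` has
-- lowest base-3 digit e, and its remaining digits form a string in row r.
-- The balance equation is the base-3/2 identity [w]_{3/2} = [bin k]_{3/2} + 2n
-- restricted to the lowest digit.
record Carry (n e r : ℕ) : Set where
  field
    bit     : Fin 2
    digit<3 : e < 3
    balance : 3 * r + e ≡ 2 * n + toℕ bit
open Carry

carry-unique : ∀ {n e r e′ r′} (c : Carry n e r) (c′ : Carry n e′ r′) → toℕ (bit c) ≡ toℕ (bit c′) →
  e ≡ e′ × r ≡ r′
carry-unique {n} c c′ same = base3-unique (digit<3 c) (digit<3 c′)
  (trans (balance c) (trans (cong (2 * n +_) same) (sym (balance c′))))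

lowest-carry : ∀ n (b : Fin 2) → Carry n (toℕ (proj₁ (lowest n (inject₁ b)))) (proj₂ (lowest n (inject₁ b)))
lowest-carry n b = record
  { bit     = b
  ; digit<3 = toℕ<n (proj₁ (lowest n (inject₁ b)))
  ; balance = trans (lowest-balance n (inject₁ b)) (cong (2 * n +_) (toℕ-inject₁ b))
  }

row-digit : ∀ {n e r} (c : Carry n e r) k → val3 (G n (toℕ (bit c) + 2 * k)) ≡ e + 3 * val3 (G r k)
row-digit {n} c k with carry-unique (lowest-carry n (bit c)) c refl
... | e≡ , r≡ = trans (column-digit n (bit c) k) (cong₂ (λ e r → e + 3 * val3 (G r k)) e≡ r≡)

data Row : ℕ → ℕ → Set where
  origin : Row 0 0
  digit  : ∀ {n e r u} → Carry n e r → Row r u → Row n (e + 3 * u)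

row-sound : ∀ {n x} → Row n x → InRow n x
row-sound origin         = 0 , refl
row-sound (digit c rows) with row-sound rows
... | k , refl = toℕ (bit c) + 2 * k , row-digit c k

divide : ∀ d .{{_ : NonZero d}} n → Σ (Fin d) λ t → Σ ℕ λ q → n ≡ toℕ t + d * q
divide d n = remainder , quotient , trans property (cong (toℕ remainder +_) (*-comm quotient d))
  where open DivMod (n divMod d)

carry-shrinks : ∀ {n e r} (c : Carry n e r) k → 0 < n + (toℕ (bit c) + 2 * k) →
  r + k < n + (toℕ (bit c) + 2 * k)
carry-shrinks {n} {e} {r} c k pos = *-cancelˡ-< 3 _ _ (begin-strict
  3 * (r + k)                                   ≡⟨ *-distribˡ-+ 3 r k ⟩
  3 * r + 3 * k                                 ≤⟨ +-monoˡ-≤ (3 * k) (m≤m+n (3 * r) e) ⟩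
  3 * r + e + 3 * k                             ≡⟨ cong (_+ 3 * k) (balance c) ⟩
  2 * n + b + 3 * k                             <⟨ m<m+n (2 * n + b + 3 * k) pos ⟩
  2 * n + b + 3 * k + (n + (b + 2 * k))         ≤⟨ m≤m+n _ (b + k) ⟩
  2 * n + b + 3 * k + (n + (b + 2 * k)) + (b + k) ≡⟨ regroup n b k ⟩
  3 * (n + (b + 2 * k))                         ∎)
  where
    open ≤-Reasoning
    b : ℕ
    b = toℕ (bit c)
    regroup : ∀ n b k → 2 * n + b + 3 * k + (n + (b + 2 * k)) + (b + k) ≡ 3 * (n + (b + 2 * k))
    regroup = solve-∀

row-complete : ∀ n k → Acc _<_ (n + k) → Row n (val3 (G n k))
row-step     : ∀ n k → 0 < n + k → Acc _<_ (n + k) → Row n (val3 (G n k))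

row-complete zero    zero    _  = origin
row-complete (suc n) k       ac = row-step (suc n) k z<s ac
row-complete zero    (suc k) ac = row-step zero (suc k) z<s ac

row-step n k pos (acc smaller) with divide 2 k
... | b , k′ , refl = subst (Row n) (sym (row-digit c k′))
        (digit c (row-complete _ k′ (smaller (carry-shrinks c k′ pos))))
  where
    c : Carry n (toℕ (proj₁ (lowest n (inject₁ b)))) (proj₂ (lowest n (inject₁ b)))
    c = lowest-carry n b

Below : Bool → ℕ → ℕ → Set
Below true  m n = m < n
Below false m n = m ≤ n

below? : ∀ s m n → Dec (Below s m n)
below? true  = _<?_
below? false = _≤?_

below-≤ : ∀ s {m n} → Below s m n → m ≤ n
below-≤ true  = <⇒≤
below-≤ false h = h

below-strict : ∀ s {m n} → m < n → Below s m n
below-strict true  h = h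
below-strict false = <⇒≤

below-≤-trans : ∀ s {m n o} → Below s m n → n ≤ o → Below s m o
below-≤-trans true  = <-≤-trans
below-≤-trans false = ≤-trans

below-+ : ∀ s c {m n} → Below s m n → Below s (c + m) (c + n)
below-+ true  c = +-monoʳ-< c
below-+ false c = +-monoʳ-≤ c

below-cancel : ∀ s c {m n} → Below s (m + c) (n + c) → Below s m n
below-cancel true  c = +-cancelʳ-< c _ _
below-cancel false c = +-cancelʳ-≤ c _ _

-- The four shapes of progressions that occur in the digit-by-digit induction.
-- A progression of a shape for x in row i consists of a in row j and b in row
-- (rowShift + j) with  lhsSlack + 2b = rhsSlack + a + x  and the indicated order
-- constraints; it exists whenever j < i (rowStrict) or j ≤ i.
--   proper : a < b < x,  2b = a + x,      j < i   (the theorem itself)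
--   low    : a ≤ b < x,  2b + 1 = a + x,  j < i
--   weak   : a ≤ b ≤ x,  2b = a + x,      j ≤ i
--   raised : a < b ≤ x,  2b = a + x + 1,  j < i, b in row j + 1
data Shape : Set where
  proper low weak raised : Shape

rowStrict abStrict bxStrict : Shape → Bool
rowStrict weak = false
rowStrict _    = true
abStrict proper = true
abStrict raised = true
abStrict _      = false
bxStrict proper = true
bxStrict low    = true
bxStrict _      = false

rowShift lhsSlack rhsSlack : Shape → ℕ
rowShift raised = 1
rowShift _      = 0
lhsSlack low = 1
lhsSlack _   = 0
rhsSlack raised = 1
rhsSlack _      = 0

record Progression (f : Shape) (j x : ℕ) : Set where
  field
    a b      : ℕ
    a-row    : Row j a
    b-row    : Row (rowShift f + j) b
    a-b      : Below (abStrict f) a b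
    b-x      : Below (bxStrict f) b x
    balanced : lhsSlack f + (b + b) ≡ rhsSlack f + (a + x)
open Progression

digitAt carryAt : ℕ → ℕ → ℕ
digitAt t d = (2 * t + d) % 3
carryAt t d = (2 * t + d) / 3

carry-at : ∀ t q (d : Fin 2) → Carry (t + 3 * q) (digitAt t (toℕ d)) (2 * q + carryAt t (toℕ d))
carry-at t q d = record
  { bit     = d
  ; digit<3 = m%n<n (2 * t + toℕ d) 3
  ; balance = begin
      3 * (2 * q + carryAt t (toℕ d)) + digitAt t (toℕ d)  ≡⟨ regroup q (carryAt t (toℕ d)) (digitAt t (toℕ d)) ⟩
      6 * q + (digitAt t (toℕ d) + carryAt t (toℕ d) * 3) ≡⟨ cong (6 * q +_) (sym (m≡m%n+[m/n]*n (2 * t + toℕ d) 3)) ⟩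
      6 * q + (2 * t + toℕ d)                             ≡⟨ regroup′ q t (toℕ d) ⟩
      2 * (t + 3 * q) + toℕ d                             ∎
  }
  where
    open ≡-Reasoning
    regroup : ∀ q h l → 3 * (2 * q + h) + l ≡ 6 * q + (l + h * 3)
    regroup = solve-∀
    regroup′ : ∀ q t d → 6 * q + (2 * t + d) ≡ 2 * (t + 3 * q) + d
    regroup′ = solve-∀

carry-residue : ∀ {t p e r} (c : Carry (t + 3 * p) e r) →
  e ≡ digitAt t (toℕ (bit c)) × r ≡ 2 * p + carryAt t (toℕ (bit c))
carry-residue {t} {p} c = carry-unique c (carry-at t p (bit c)) refl

-- Lifts s′ s α β: an s′-comparison a ≺ b of higher parts yields the
-- s-comparison α + 3a ≺ β + 3b after appending the low digits α, β.  A strict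
-- comparison always does (digits are < 3); a non-strict one needs α ≺ β.
Lifts : Bool → Bool → ℕ → ℕ → Set
Lifts true  _ _ _ = ⊤
Lifts false s α β = Below s α β

lifts? : ∀ s′ s α β → Dec (Lifts s′ s α β)
lifts? true  _ _ _ = yes tt
lifts? false s α β = below? s α β

lift-below : ∀ s′ s {α β a b} → α < 3 → Lifts s′ s α β → Below s′ a b → Below s (α + 3 * a) (β + 3 * b)
lift-below true s {α} {β} {a} {b} α<3 _ a<b = below-strict s (begin-strict
  α + 3 * a  <⟨ +-monoˡ-< (3 * a) α<3 ⟩
  3 + 3 * a  ≡⟨ sym (*-suc 3 a) ⟩
  3 * suc a  ≤⟨ *-monoʳ-≤ 3 a<b ⟩
  3 * b      ≤⟨ m≤n+m (3 * b) β ⟩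
  β + 3 * b  ∎)
  where open ≤-Reasoning
lift-below false true  _ α<β a≤b = +-mono-<-≤ α<β (*-monoʳ-≤ 3 a≤b)
lift-below false false _ α≤β a≤b = +-mono-≤ α≤β (*-monoʳ-≤ 3 a≤b)

append-balance : ∀ L R L′ R′ α β e a b u →
  L + (β + β) + 3 * R′ ≡ R + (α + e) + 3 * L′ → L′ + (b + b) ≡ R′ + (a + u) →
  L + ((β + 3 * b) + (β + 3 * b)) ≡ R + ((α + 3 * a) + (e + 3 * u))
append-balance L R L′ R′ α β e a b u digits rest = +-cancelʳ-≡ (3 * R′) _ _ (begin
  L + ((β + 3 * b) + (β + 3 * b)) + 3 * R′  ≡⟨ split L R′ β b ⟩
  L + (β + β) + 3 * R′ + 3 * (b + b)        ≡⟨ cong (_+ 3 * (b + b)) digits ⟩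
  R + (α + e) + 3 * L′ + 3 * (b + b)        ≡⟨ join R α e L′ (b + b) ⟩
  R + (α + e) + 3 * (L′ + (b + b))          ≡⟨ cong (λ v → R + (α + e) + 3 * v) rest ⟩
  R + (α + e) + 3 * (R′ + (a + u))          ≡⟨ unsplit R R′ α e a u ⟩
  R + ((α + 3 * a) + (e + 3 * u)) + 3 * R′  ∎)
  where
    open ≡-Reasoning
    split : ∀ L R′ β b → L + ((β + 3 * b) + (β + 3 * b)) + 3 * R′ ≡ L + (β + β) + 3 * R′ + 3 * (b + b)
    split = solve-∀
    join : ∀ R α e L′ s → R + (α + e) + 3 * L′ + 3 * s ≡ R + (α + e) + 3 * (L′ + s)
    join = solve-∀
    unsplit : ∀ R R′ α e a u → R + (α + e) + 3 * (R′ + (a + u)) ≡ R + ((α + 3 * a) + (e + 3 * u)) + 3 * R′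
    unsplit = solve-∀

-- In a progression of shape f for x (row
-- ti + 3p, column bit dx) from row tj + 3q, the lowest digits of a and b come
-- from the bits da and db; the higher parts must form a progression of shape f′
-- for the higher part of x.  Here k + q ≤ p (k = 1 when q < p).  The fields say:
-- b's higher part lies in the row shape f′ asks for (shift-ok), the higher rows
-- compare as f′ requires (row-ok), the low digits balance the slacks
-- (slack-ok), and the order constraints survive (ab-ok, bx-ok).
record Plan (f : Shape) (ti dx tj k da db : ℕ) (f′ : Shape) : Set where
  field
    shift-ok : carryAt (rowShift f + tj) db ≡ rowShift f′ + carryAt tj da
    row-ok   : Below (rowStrict f′) (carryAt tj da) (2 * k + carryAt ti dx)
    slack-ok : lhsSlack f + (digitAt (rowShift f + tj) db + digitAt (rowShift f + tj) db) + 3 * rhsSlack f′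
               ≡ rhsSlack f + (digitAt tj da + digitAt ti dx) + 3 * lhsSlack f′
    ab-ok    : Lifts (abStrict f′) (abStrict f) (digitAt tj da) (digitAt (rowShift f + tj) db)
    bx-ok    : Lifts (bxStrict f′) (bxStrict f) (digitAt (rowShift f + tj) db) (digitAt ti dx)
open Plan

plan? : ∀ f ti dx tj k da db f′ → Dec (Plan f ti dx tj k da db f′)
plan? f ti dx tj k da db f′ =
  map′ (λ (s , r , l , ab , bx) → record { shift-ok = s ; row-ok = r ; slack-ok = l ; ab-ok = ab ; bx-ok = bx })
       (λ p → shift-ok p , row-ok p , slack-ok p , ab-ok p , bx-ok p)
       ((_ ≟ _) ×-dec below? (rowStrict f′) _ _ ×-dec (_ ≟ _) ×-dec
        lifts? (abStrict f′) (abStrict f) α β ×-dec lifts? (bxStrict f′) (bxStrict f) β e)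
  where
    α β e : ℕ
    α = digitAt tj da
    β = digitAt (rowShift f + tj) db
    e = digitAt ti dx

-- A plan is needed only when the step is possible: when q = p, the hypothesis
-- j < i (or j ≤ i) forces tj < ti (or tj ≤ ti).
Feasible : Bool → ℕ → ℕ → ℕ → Set
Feasible s tj ti zero    = Below s tj ti
Feasible s tj ti (suc _) = ⊤

feasible? : ∀ s tj ti k → Dec (Feasible s tj ti k)
feasible? s tj ti zero    = below? s tj ti
feasible? s tj ti (suc _) = yes tt

∀-shape? : {P : Shape → Set} → (∀ f → Dec (P f)) → Dec (∀ f → P f)
∀-shape? P? = map′ (λ (p , l , w , r) → λ { proper → p ; low → l ; weak → w ; raised → r })
                   (λ h → h proper , h low , h weak , h raised)
                   (P? proper ×-dec P? low ×-dec P? weak ×-dec P? raised)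

∃-shape? : {P : Shape → Set} → (∀ f → Dec (P f)) → Dec (Σ Shape P)
∃-shape? {P} P? = map′ from to (P? proper ⊎-dec P? low ⊎-dec P? weak ⊎-dec P? raised)
  where
    from : P proper ⊎ P low ⊎ P weak ⊎ P raised → Σ Shape P
    from (inj₁ p)               = proper , p
    from (inj₂ (inj₁ p))        = low , p
    from (inj₂ (inj₂ (inj₁ p))) = weak , p
    from (inj₂ (inj₂ (inj₂ p))) = raised , p
    to : Σ Shape P → P proper ⊎ P low ⊎ P weak ⊎ P raised
    to (proper , p) = inj₁ p
    to (low , p)    = inj₂ (inj₁ p)
    to (weak , p)   = inj₂ (inj₂ (inj₁ p))
    to (raised , p) = inj₂ (inj₂ (inj₂ p))

-- Every feasible digit step has a plan: a finite check over the shape, the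
-- residues of i and j, the bit of x and q <? p, settled by evaluating the
-- decision procedure.  The certificate is opaque: it is only ever applied.
Plans : Set
Plans = ∀ f (ti : Fin 3) (dx : Fin 2) (tj : Fin 3) (k : Fin 2) →
  Feasible (rowStrict f) (toℕ tj) (toℕ ti) (toℕ k) →
  Σ (Fin 2) λ da → Σ (Fin 2) λ db → Σ Shape λ f′ →
    Plan f (toℕ ti) (toℕ dx) (toℕ tj) (toℕ k) (toℕ da) (toℕ db) f′

opaque
  plans : Plans
  plans = toWitness {a? = ∀-shape? λ f → all? λ ti → all? λ dx → all? λ tj → all? λ k →
            feasible? (rowStrict f) (toℕ tj) (toℕ ti) (toℕ k) →-dec
            (any? λ da → any? λ db → ∃-shape? λ f′ →
               plan? f (toℕ ti) (toℕ dx) (toℕ tj) (toℕ k) (toℕ da) (toℕ db) f′)} _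

extend : ∀ {f ti dx tj k f′} (da db : Fin 2) q u →
  Plan f ti dx tj k (toℕ da) (toℕ db) f′ →
  Progression f′ (2 * q + carryAt tj (toℕ da)) u →
  Progression f (tj + 3 * q) (digitAt ti dx + 3 * u)
extend {f} {ti} {dx} {tj} {k} {f′} da db q u plan higher = record
  { a        = digitAt tj (toℕ da) + 3 * a higher
  ; b        = β + 3 * b higher
  ; a-row    = digit (carry-at tj q da) (a-row higher)
  ; b-row    = subst (λ n → Row n (β + 3 * b higher)) (+-assoc (rowShift f) tj (3 * q))
                 (digit (carry-at (rowShift f + tj) q db) (subst (λ n → Row n (b higher)) b-index (b-row higher)))
  ; a-b      = lift-below (abStrict f′) (abStrict f) (m%n<n (2 * tj + toℕ da) 3) (ab-ok plan) (a-b higher)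
  ; b-x      = lift-below (bxStrict f′) (bxStrict f) (m%n<n (2 * (rowShift f + tj) + toℕ db) 3) (bx-ok plan) (b-x higher)
  ; balanced = append-balance (lhsSlack f) (rhsSlack f) (lhsSlack f′) (rhsSlack f′)
                 (digitAt tj (toℕ da)) β (digitAt ti dx) (a higher) (b higher) u (slack-ok plan) (balanced higher)
  }
  where
    β : ℕ
    β = digitAt (rowShift f + tj) (toℕ db)
    b-index : rowShift f′ + (2 * q + carryAt tj (toℕ da)) ≡ 2 * q + carryAt (rowShift f + tj) (toℕ db)
    b-index = trans (+-comm (rowShift f′) _)
                (trans (+-assoc (2 * q) _ (rowShift f′))
                  (cong (2 * q +_) (trans (+-comm _ (rowShift f′)) (sym (shift-ok plan)))))

compare-blocks : ∀ s (ti : Fin 3) p (tj : Fin 3) q → Below s (toℕ tj + 3 * q) (toℕ ti + 3 * p) →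
  Σ (Fin 2) λ k → toℕ k + q ≤ p × Feasible s (toℕ tj) (toℕ ti) (toℕ k)
compare-blocks s ti p tj q j≺i with <-cmp q p
... | tri< q<p _ _ = suc zero , q<p , tt
... | tri≈ _ refl _ = zero , ≤-refl , below-cancel s (3 * q) j≺i
... | tri> _ _ p<q = ⊥-elim (<-irrefl refl (≤-<-trans (below-≤ s j≺i) (begin-strict
  toℕ ti + 3 * p  <⟨ +-monoˡ-< (3 * p) (toℕ<n ti) ⟩
  3 + 3 * p       ≡⟨ sym (*-suc 3 p) ⟩
  3 * suc p       ≤⟨ *-monoʳ-≤ 3 p<q ⟩
  3 * q           ≤⟨ m≤n+m (3 * q) (toℕ tj) ⟩
  toℕ tj + 3 * q  ∎)))
  where open ≤-Reasoning

higher-row : ∀ s k q p h h′ → k + q ≤ p → Below s h (2 * k + h′) → Below s (2 * q + h) (2 * p + h′)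
higher-row s k q p h h′ k+q≤p h≺ = below-≤-trans s (below-+ s (2 * q) h≺) (begin
  2 * q + (2 * k + h′) ≡⟨ regroup q k h′ ⟩
  2 * (k + q) + h′     ≤⟨ +-monoˡ-≤ h′ (*-monoʳ-≤ 2 k+q≤p) ⟩
  2 * p + h′           ∎)
  where
    open ≤-Reasoning
    regroup : ∀ q k h′ → 2 * q + (2 * k + h′) ≡ 2 * (k + q) + h′
    regroup = solve-∀

progression-digit : ∀ f {i e r u} → Carry i e r →
  (∀ f′ j′ → Below (rowStrict f′) j′ r → Progression f′ j′ u) →
  ∀ j → Below (rowStrict f) j i → Progression f j (e + 3 * u)
progression-digit f {i} {e} {r} {u} c higher j j≺i with divide 3 i | divide 3 j
... | ti , p , refl | tj , q , refl with compare-blocks (rowStrict f) ti p tj q j≺i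
... | k , k+q≤p , feasible with plans f ti (bit c) tj k feasible | carry-residue {toℕ ti} {p} c
... | da , db , f′ , plan | e≡ , r≡ =
  subst (λ e → Progression f (toℕ tj + 3 * q) (e + 3 * u)) (sym e≡)
    (extend da db q u plan (higher f′ (2 * q + carryAt (toℕ tj) (toℕ da)) rows-compare))
  where
    rows-compare : Below (rowStrict f′) (2 * q + carryAt (toℕ tj) (toℕ da)) r
    rows-compare = subst (Below (rowStrict f′) _) (sym r≡)
      (higher-row (rowStrict f′) (toℕ k) q p _ _ k+q≤p (row-ok plan))

progression : ∀ f {i x} → Row i x → ∀ j → Below (rowStrict f) j i → Progression f j x
progression proper origin j ()
progression low    origin j ()
progression raised origin j ()
progression weak   origin .0 z≤n = record
  { a = 0 ; b = 0 ; a-row = origin ; b-row = origin ; a-b = z≤n ; b-x = z≤n ; balanced = refl }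
progression f (digit c rows) j j≺i = progression-digit f c (λ f′ → progression f′ rows) j j≺i

theorem11 : (i j : ℕ) → j < i → (x : ℕ) → InRow i x →
    Σ ℕ λ a → Σ ℕ λ b → InRow j a × InRow j b × a < b × b < x × b + b ≡ a + x
theorem11 i j j<i x (k , refl) =
  a ap , b ap , row-sound (a-row ap) , row-sound (b-row ap) , a-b ap , b-x ap , balanced ap
  where
    ap : Progression proper j (val3 (G i k))
    ap = progression proper (row-complete i k (<-wellFounded (i + k))) j j<i
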